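{- Let $\xi$ be an address, $n\in\mathbb N$, $\mathfrak D,\mathfrak D'\in\mathbb L_n$, and $\mathfrak c$ a chronicle of $\mathfrak D$. Then either $\mathfrak c\in\mathfrak D'$, or there exist $i,j\in\mathbb N$ and a sequence of actions $\mathfrak c'$ such that either ($\mathfrak c'(+,\xi.\underline i.0.1.\overline j,\{0\})$ is a prefix of $\mathfrak c$ and $\mathfrak c'(+,\xi.\underline i.0.1.\overline j,\emptyset)\in\mathfrak D'$) or ($\mathfrak c=\mathfrak c'(+,\xi.\underline i.0.1.\overline j,\emptyset)$ and $\mathfrak c'(+,\xi.\underline i.0.1.\overline j,\{0\})\in\mathfrak D'$).
   Context: Ludics: actions are $(+,\xi,I)$, $(-,\xi,I)$ (address a finite sequence of naturals, $I$ finite set of naturals) or daimon $\maltese$; a design is a prefix-closed set of chronicles (finite alternating sequences of actions). Notation: $\overline0=\epsilon$, $\overline{k+1}=\overline k.0.1$, $\underline 0=\epsilon$, $\underline{k+1}=\underline k.1.1$. Naturals: $\mathbf 0_\tau=\{(+,\tau,\emptyset)\}$, $(\mathbf{k+1})_\tau$ the prefix closure of $\{(+,\tau,\{0\})(-,\tau.0,\{1\})\mathfrak c\mid\mathfrak c\in\mathbf k_{\tau.0.1}\}$. Lists: $\mathfrak D^{\epsilon}_\xi=\{(+,\xi,\emptyset)\}$; for $n>0$, $\mathfrak D^{\langle a_1,\dots,a_n\rangle}_\xi$ is the prefix closure of $\{(+,\xi,\{0,1\})(-,\xi.0,\{1\})\mathfrak c\mid\mathfrak c\in(\mathbf a_1)_{\xi.0.1}\}\cup\{(+,\xi,\{0,1\})(-,\xi.1,\{1\})\mathfrak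 c\mid\mathfrak c\in\mathfrak D^{\langle a_2,\dots,a_n\rangle}_{\xi.1.1}\}$; $\mathbb L_n=\{\mathfrak D^{\langle a_1,\dots,a_n\rangle}_\xi\mid a_i\in\mathbb N\}$. -}

module Defs where

open import Data.Nat using (ℕ; zero; suc)
open import Data.List using (List; []; _∷_; _++_; [_])
open import Data.Product using (Σ; ∃; _×_; _,_)
open import Relation.Binary.PropositionalEquality using (_≡_)

-- Addresses: finite sequences of naturals; ξ.i is ξ ++ [ i ].
Address : Set
Address = List ℕ

-- Finite sets of naturals, represented as strictly increasing lists
-- (all sets occurring here are ∅, {0}, {1}, {0,1}, written [], [0], [1], [0,1]).
FinSetℕ : Set
FinSetℕ = List ℕ

data Polarity : Set where
  pos neg : Polarity

data Action : Set where
  act    : Polarity → Address → FinSetℕ → Action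
  daimon : Action

Chronicle : Set
Chronicle = List Action

infix 4 _≼_
_≼_ : Chronicle → Chronicle → Set
c ≼ d = Σ Chronicle λ s → c ++ s ≡ d

over : ℕ → Address
over zero    = []
over (suc k) = over k ++ (0 ∷ 1 ∷ [])

under : ℕ → Address
under zero    = []
under (suc k) = under k ++ (1 ∷ 1 ∷ [])

-- The unique maximal chronicle of the natural number design k_τ.
natMax : ℕ → Address → Chronicle
natMax zero    τ = act pos τ [] ∷ []
natMax (suc k) τ = act pos τ (0 ∷ []) ∷ act neg (τ ++ [ 0 ]) (1 ∷ []) ∷ natMax k (τ ++ (0 ∷ 1 ∷ []))

NatDesign : ℕ → Address → Chronicle → Set
NatDesign k τ c = c ≼ natMax k τ

-- Generating (maximal) chronicles of the list design D^l_ξ.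
data ListMax : List ℕ → Address → Chronicle → Set where
  nil  : ∀ {ξ} → ListMax [] ξ (act pos ξ [] ∷ [])
  head : ∀ {a l ξ c} → NatDesign a (ξ ++ (0 ∷ 1 ∷ [])) c →
         ListMax (a ∷ l) ξ (act pos ξ (0 ∷ 1 ∷ []) ∷ act neg (ξ ++ [ 0 ]) (1 ∷ []) ∷ c)
  tail : ∀ {a l ξ c} → ListMax l (ξ ++ (1 ∷ 1 ∷ [])) c →
         ListMax (a ∷ l) ξ (act pos ξ (0 ∷ 1 ∷ []) ∷ act neg (ξ ++ [ 1 ]) (1 ∷ []) ∷ c)

ListDesign : List ℕ → Address → Chronicle → Set
ListDesign l ξ c = ∃ λ d → ListMax l ξ d × c ≼ d

module Submission where

open import Defs
open import Data.Nat using (ℕ; zero; suc)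
open import Data.List using (List; []; _∷_; _++_; [_])
open import Data.List.Properties using (++-assoc; ++-identityʳ; ∷-injective)
open import Data.Vec using (Vec; toList) renaming ([] to []ᵥ; _∷_ to _∷ᵥ_)
open import Data.Product using (Σ; _×_; _,_)
open import Data.Sum using (_⊎_; inj₁; inj₂)
import Data.Sum as Sum
open import Relation.Binary.PropositionalEquality
  using (_≡_; refl; sym; trans; cong; subst)

≼-[] : ∀ c → [] ≼ c
≼-[] c = c , refl

≼-refl : ∀ c → c ≼ c
≼-refl c = [] , ++-identityʳ c

≼-trans : ∀ {a b c} → a ≼ b → b ≼ c → a ≼ c
≼-trans {a} (s , refl) (t , refl) = s ++ t , sym (++-assoc a s t)

[x]≼x∷ : ∀ x r → [ x ] ≼ x ∷ r
[x]≼x∷ x r = r , refl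

∷-mono-≼ : ∀ {x c d} → c ≼ d → x ∷ c ≼ x ∷ d
∷-mono-≼ {x} (s , e) = s , cong (x ∷_) e

∷-cancel-≼ : ∀ {x y c d} → x ∷ c ≼ y ∷ d → x ≡ y × c ≼ d
∷-cancel-≼ (s , e) = let (x≡y , e′) = ∷-injective e in x≡y , (s , e′)

Divergence : (Chronicle → Set) → Address → Chronicle → Set
Divergence D α c = Σ Chronicle λ c′ →
    ((c′ ++ [ act pos α (0 ∷ []) ] ≼ c) × D (c′ ++ [ act pos α [] ]))
    ⊎ ((c ≡ c′ ++ [ act pos α [] ]) × D (c′ ++ [ act pos α (0 ∷ []) ]))

divergeContinuing : ∀ D {α c} → [ act pos α (0 ∷ []) ] ≼ c → D [ act pos α [] ] →
                    Divergence D α c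
divergeContinuing D c≽ d = [] , inj₁ (c≽ , d)

divergeStopping : ∀ D {α} → D [ act pos α (0 ∷ []) ] → Divergence D α [ act pos α [] ]
divergeStopping D d = [] , inj₂ (refl , d)

divergence-∷∷ : ∀ (D D′ : Chronicle → Set) {α c} {x y : Action} →
                (∀ {z} → D z → D′ (x ∷ y ∷ z)) →
                Divergence D α c → Divergence D′ α (x ∷ y ∷ c)
divergence-∷∷ D D′ {x = x} {y} f (c′ , inj₁ (c≽ , d)) = x ∷ y ∷ c′ , inj₁ (∷-mono-≼ (∷-mono-≼ c≽) , f d)
divergence-∷∷ D D′ {x = x} {y} f (c′ , inj₂ (c≡ , d)) = x ∷ y ∷ c′ , inj₂ (cong (λ t → x ∷ y ∷ t) c≡ , f d)

-- Moving one layer 0.1 (resp. 1.1) from the base address into j̄ (resp. i̲);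
-- needed when a divergence found one layer down is read at the top.

over-shift : ∀ τ j → (τ ++ (0 ∷ 1 ∷ [])) ++ over j ≡ τ ++ over (suc j)
over-shift τ j = trans (++-assoc τ _ (over j)) (cong (τ ++_) (sym (over-comm j)))
  where
  over-comm : ∀ j → over j ++ (0 ∷ 1 ∷ []) ≡ (0 ∷ 1 ∷ []) ++ over j
  over-comm zero    = refl
  over-comm (suc j) = cong (_++ (0 ∷ 1 ∷ [])) (over-comm j)

under-shift : ∀ ξ i w → (ξ ++ (1 ∷ 1 ∷ [])) ++ under i ++ w ≡ ξ ++ under (suc i) ++ w
under-shift ξ i w = trans (++-assoc ξ _ _)
  (cong (ξ ++_) (trans (sym (++-assoc (1 ∷ 1 ∷ []) (under i) w))
                       (cong (_++ w) (sym (under-comm i)))))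
  where
  under-comm : ∀ i → under i ++ (1 ∷ 1 ∷ []) ≡ (1 ∷ 1 ∷ []) ++ under i
  under-comm zero    = refl
  under-comm (suc i) = cong (_++ (1 ∷ 1 ∷ [])) (under-comm i)

data NatView : ℕ → Address → Chronicle → Set where
  empty   : ∀ {k τ} → NatView k τ []
  zeroMax : ∀ {τ} → NatView zero τ [ act pos τ [] ]
  sucRoot : ∀ {k τ} → NatView (suc k) τ [ act pos τ (0 ∷ []) ]
  sucStep : ∀ {k τ r} → NatDesign k (τ ++ (0 ∷ 1 ∷ [])) r →
            NatView (suc k) τ (act pos τ (0 ∷ []) ∷ act neg (τ ++ [ 0 ]) (1 ∷ []) ∷ r)

natView : ∀ k τ c → NatDesign k τ c → NatView k τ c
natView k       τ []            _ = empty
natView zero    τ (x ∷ r)       p with ∷-cancel-≼ p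
natView zero    τ (x ∷ [])      p | refl , _ = zeroMax
natView zero    τ (x ∷ _ ∷ _)   p | refl , (_ , ())
natView (suc k) τ (x ∷ [])      p with ∷-cancel-≼ p
... | refl , _ = sucRoot
natView (suc k) τ (x ∷ y ∷ r)   p with ∷-cancel-≼ p
... | refl , q with ∷-cancel-≼ q
...   | refl , q′ = sucStep q′

nat-zero : ∀ {τ} → NatDesign zero τ [ act pos τ [] ]
nat-zero = ≼-refl _

nat-root : ∀ {k τ} → NatDesign (suc k) τ [ act pos τ (0 ∷ []) ]
nat-root = [x]≼x∷ _ _

nat-step : ∀ {k τ r} → NatDesign k (τ ++ (0 ∷ 1 ∷ [])) r →
           NatDesign (suc k) τ (act pos τ (0 ∷ []) ∷ act neg (τ ++ [ 0 ]) (1 ∷ []) ∷ r)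
nat-step q = ∷-mono-≼ (∷-mono-≼ q)

atDepthZero : ∀ D {τ c} → Divergence D τ c → Σ ℕ λ j → Divergence D (τ ++ over j) c
atDepthZero D {τ} {c} δ = 0 , subst (λ α → Divergence D α c) (sym (++-identityʳ τ)) δ

natComparison : ∀ {a} b τ c → NatDesign a τ c →
  NatDesign b τ c ⊎ Σ ℕ λ j → Divergence (NatDesign b τ) (τ ++ over j) c
natComparison {a} b τ c p with natView a τ c p
natComparison b       τ _ _ | empty     = inj₁ (≼-[] _)
natComparison zero    τ _ _ | zeroMax   = inj₁ nat-zero
natComparison (suc b) τ _ _ | zeroMax   =
  inj₂ (atDepthZero (NatDesign (suc b) τ) (divergeStopping (NatDesign (suc b) τ) nat-root))
natComparison zero    τ _ _ | sucRoot   =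
  inj₂ (atDepthZero (NatDesign zero τ) (divergeContinuing (NatDesign zero τ) (≼-refl _) nat-zero))
natComparison (suc b) τ _ _ | sucRoot   = inj₁ nat-root
natComparison zero    τ _ _ | sucStep _ =
  inj₂ (atDepthZero (NatDesign zero τ) (divergeContinuing (NatDesign zero τ) ([x]≼x∷ _ _) nat-zero))
natComparison (suc b) τ _ _ | sucStep {r = r} q =
  Sum.map nat-step deeper (natComparison b (τ ++ (0 ∷ 1 ∷ [])) r q)
  where
  deeper : (Σ ℕ λ j → Divergence (NatDesign b (τ ++ (0 ∷ 1 ∷ []))) ((τ ++ (0 ∷ 1 ∷ [])) ++ over j) r) →
           Σ ℕ λ j → Divergence (NatDesign (suc b) τ) (τ ++ over j)
                       (act pos τ (0 ∷ []) ∷ act neg (τ ++ [ 0 ]) (1 ∷ []) ∷ r)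
  deeper (j , δ) = suc j , subst (λ α → Divergence (NatDesign (suc b) τ) α _)
                                 (over-shift τ j)
                                 (divergence-∷∷ (NatDesign b _) (NatDesign (suc b) τ) nat-step δ)

data ListView (a : ℕ) (l : List ℕ) (ξ : Address) : Chronicle → Set where
  empty  : ListView a l ξ []
  root   : ListView a l ξ [ act pos ξ (0 ∷ 1 ∷ []) ]
  inHead : ∀ {r} → NatDesign a (ξ ++ (0 ∷ 1 ∷ [])) r →
           ListView a l ξ (act pos ξ (0 ∷ 1 ∷ []) ∷ act neg (ξ ++ [ 0 ]) (1 ∷ []) ∷ r)
  inTail : ∀ {r} → ListDesign l (ξ ++ (1 ∷ 1 ∷ [])) r →
           ListView a l ξ (act pos ξ (0 ∷ 1 ∷ []) ∷ act neg (ξ ++ [ 1 ]) (1 ∷ []) ∷ r)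

listView : ∀ a l ξ c → ListDesign (a ∷ l) ξ c → ListView a l ξ c
listView a l ξ [] _ = empty
listView a l ξ (x ∷ []) (_ , head _ , p) with ∷-cancel-≼ p
... | refl , _ = root
listView a l ξ (x ∷ []) (_ , tail _ , p) with ∷-cancel-≼ p
... | refl , _ = root
listView a l ξ (x ∷ y ∷ r) (_ , head nd , p) with ∷-cancel-≼ p
... | refl , q with ∷-cancel-≼ q
...   | refl , q′ = inHead (≼-trans q′ nd)
listView a l ξ (x ∷ y ∷ r) (_ , tail {c = d} lm , p) with ∷-cancel-≼ p
... | refl , q with ∷-cancel-≼ q
...   | refl , q′ = inTail (d , lm , q′)

list-empty : ∀ l ξ → ListDesign l ξ []
list-empty []      ξ = _ , nil , ≼-[] _
list-empty (a ∷ l) ξ = _ , head {c = []} (≼-[] _) , ≼-[] _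

list-root : ∀ {a l ξ} → ListDesign (a ∷ l) ξ [ act pos ξ (0 ∷ 1 ∷ []) ]
list-root = _ , head {c = []} (≼-[] _) , [x]≼x∷ _ _

list-head : ∀ {a l ξ r} → NatDesign a (ξ ++ (0 ∷ 1 ∷ [])) r →
            ListDesign (a ∷ l) ξ (act pos ξ (0 ∷ 1 ∷ []) ∷ act neg (ξ ++ [ 0 ]) (1 ∷ []) ∷ r)
list-head nd = _ , head nd , ≼-refl _

list-tail : ∀ {a l ξ r} → ListDesign l (ξ ++ (1 ∷ 1 ∷ [])) r →
            ListDesign (a ∷ l) ξ (act pos ξ (0 ∷ 1 ∷ []) ∷ act neg (ξ ++ [ 1 ]) (1 ∷ []) ∷ r)
list-tail (_ , lm , q) = _ , tail lm , ∷-mono-≼ (∷-mono-≼ q)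

entryAddress : Address → ℕ → ℕ → Address
entryAddress ξ i j = ξ ++ under i ++ (0 ∷ 1 ∷ []) ++ over j

listComparison : ∀ {n} (as bs : Vec ℕ n) ξ c → ListDesign (toList as) ξ c →
  ListDesign (toList bs) ξ c
  ⊎ Σ ℕ λ i → Σ ℕ λ j → Divergence (ListDesign (toList bs) ξ) (entryAddress ξ i j) c
listComparison []ᵥ []ᵥ ξ c p = inj₁ p
listComparison (a ∷ᵥ as) (b ∷ᵥ bs) ξ c p with listView a (toList as) ξ c p
... | empty  = inj₁ (list-empty _ ξ)
... | root   = inj₁ list-root
... | inHead {r} q = Sum.map list-head inHeadEntry (natComparison b (ξ ++ (0 ∷ 1 ∷ [])) r q)
  where
  inHeadEntry : (Σ ℕ λ j → Divergence (NatDesign b (ξ ++ (0 ∷ 1 ∷ []))) ((ξ ++ (0 ∷ 1 ∷ [])) ++ over j) r) →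
                Σ ℕ λ i → Σ ℕ λ j → Divergence (ListDesign (b ∷ toList bs) ξ) (entryAddress ξ i j) c
  inHeadEntry (j , δ) = 0 , j , subst (λ α → Divergence (ListDesign (b ∷ toList bs) ξ) α c)
    (++-assoc ξ _ (over j))
    (divergence-∷∷ (NatDesign b _) (ListDesign (b ∷ toList bs) ξ) list-head δ)
... | inTail {r} q = Sum.map list-tail inTailEntry (listComparison as bs (ξ ++ (1 ∷ 1 ∷ [])) r q)
  where
  inTailEntry : (Σ ℕ λ i → Σ ℕ λ j → Divergence (ListDesign (toList bs) (ξ ++ (1 ∷ 1 ∷ [])))
                                                 (entryAddress (ξ ++ (1 ∷ 1 ∷ [])) i j) r) →
                Σ ℕ λ i → Σ ℕ λ j → Divergence (ListDesign (b ∷ toList bs) ξ) (entryAddress ξ i j) c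
  inTailEntry (i , j , δ) = suc i , j , subst (λ α → Divergence (ListDesign (b ∷ toList bs) ξ) α c)
    (under-shift ξ i _)
    (divergence-∷∷ (ListDesign (toList bs) _) (ListDesign (b ∷ toList bs) ξ) list-tail δ)

mainTheorem14 : (ξ : Address) (n : ℕ) (as bs : Vec ℕ n) (c : Chronicle) →
    ListDesign (toList as) ξ c →
    ListDesign (toList bs) ξ c
    ⊎ Σ ℕ λ i → Σ ℕ λ j → Σ Chronicle λ c' →
        ((c' ++ [ act pos (ξ ++ under i ++ (0 ∷ 1 ∷ []) ++ over j) (0 ∷ []) ] ≼ c)
          × ListDesign (toList bs) ξ (c' ++ [ act pos (ξ ++ under i ++ (0 ∷ 1 ∷ []) ++ over j) [] ]))
        ⊎ ((c ≡ c' ++ [ act pos (ξ ++ under i ++ (0 ∷ 1 ∷ []) ++ over j) [] ])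
          × ListDesign (toList bs) ξ (c' ++ [ act pos (ξ ++ under i ++ (0 ∷ 1 ∷ []) ++ over j) (0 ∷ []) ]))
mainTheorem14 ξ n as bs c = listComparison as bs ξ c
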